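{- Let $f \in \mathbb{Z}[x]$ be such that all iterates $f^n$ are separable, $0$ is a critical point of $f$, and $(f^n(0))_{n \geq 1}$ is a rigid divisibility sequence taking infinitely many values. If $g \in \mathbb{Z}[x]$ divides $f$ (i.e. $f = gh$ with $h \in \mathbb{Z}[x]$), then the sequence $(b_n)_{n \geq 1}$ with $b_n = g(f^{n-1}(0))$, i.e. $g(0), g(f(0)), g(f^2(0)), \ldots$, is a rigid divisibility sequence.
   Context: $f^n$ denotes the $n$-th iterate of $f$, with $f^0(x) = x$. A sequence $(c_n)_{n \geq 1}$ of integers is a rigid divisibility sequence if for every prime $p$ and every $n \geq 1$, $v_p(c_n) > 0$ implies $v_p(c_{mn}) = v_p(c_n)$ for all $m \geq 1$, where $v_p$ is the $p$-adic valuation. -}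

module Defs where

open import Data.Nat using (ℕ; zero; suc) renaming (_+_ to _+ℕ_)
open import Data.Nat.Primality using (Prime)
open import Data.Integer using (ℤ; +_; _+_; _*_; _^_)
open import Data.Integer.Divisibility using (_∣_)
open import Data.List using (List; []; _∷_; foldr; map)
open import Data.List.Membership.Propositional using (_∈_)
open import Data.Product using (Σ; ∃; _×_; _,_)
open import Relation.Binary.PropositionalEquality using (_≡_; _≢_)
open import Relation.Nullary using (¬_)
open import Function.Bundles using (_⇔_)

-- Polynomials in ℤ[x] as coefficient lists, lowest degree first.
Poly : Set
Poly = List ℤ

coeff : Poly → ℕ → ℤ
coeff []      _       = + 0
coeff (a ∷ p) zero    = a
coeff (a ∷ p) (suc i) = coeff p i

-- equality of polynomials (coefficientwise, ignoring trailing zeros)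
infix 4 _≈_
_≈_ : Poly → Poly → Set
p ≈ q = ∀ i → coeff p i ≡ coeff q i

infixl 6 _⊕_
_⊕_ : Poly → Poly → Poly
[]      ⊕ q       = q
(a ∷ p) ⊕ []      = a ∷ p
(a ∷ p) ⊕ (b ∷ q) = (a + b) ∷ (p ⊕ q)

infixl 7 _⊗_
_⊗_ : Poly → Poly → Poly
[]      ⊗ q = []
(a ∷ p) ⊗ q = map (a *_) q ⊕ (+ 0 ∷ (p ⊗ q))

const : ℤ → Poly
const c = c ∷ []

X : Poly
X = + 0 ∷ + 1 ∷ []

_∘ₚ_ : Poly → Poly → Poly
p ∘ₚ q = foldr (λ a acc → const a ⊕ (q ⊗ acc)) [] p

iterP : ℕ → Poly → Poly
iterP zero    f = X
iterP (suc n) f = f ∘ₚ iterP n f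

derivFrom : ℕ → Poly → Poly
derivFrom k []      = []
derivFrom k (a ∷ p) = (+ k * a) ∷ derivFrom (suc k) p

deriv : Poly → Poly
deriv []      = []
deriv (a ∷ p) = derivFrom 1 p

eval : Poly → ℤ → ℤ
eval p x = foldr (λ a acc → a + x * acc) (+ 0) p

iterF : ℕ → Poly → ℤ → ℤ
iterF zero    f x = x
iterF (suc n) f x = eval f (iterF n f x)

-- separable: gcd(f, f') = 1 in ℚ[x]; after clearing denominators:
-- a f + b f' = c for some a, b ∈ ℤ[x] and a nonzero constant c ∈ ℤ.
Separable : Poly → Set
Separable f = Σ Poly λ a → Σ Poly λ b → Σ ℤ λ c →
  (c ≢ + 0) × (a ⊗ f ⊕ b ⊗ deriv f ≈ const c)

CriticalAt0 : Poly → Set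
CriticalAt0 f = eval (deriv f) (+ 0) ≡ + 0

_∣ₚ_ : Poly → Poly → Set
g ∣ₚ f = Σ Poly λ h → f ≈ g ⊗ h

-- v_p(a) = v_p(b) (valuations in ℕ ∪ {∞}): p^k ∣ a ⇔ p^k ∣ b for all k
SameVal : ℕ → ℤ → ℤ → Set
SameVal p a b = ∀ k → ((+ p) ^ k ∣ a) ⇔ ((+ p) ^ k ∣ b)

-- rigid divisibility sequence; c : ℕ → ℤ with c n meaning c_(n+1)
-- (so the sequence is indexed from 1).  v_p(c_n) > 0 ⇔ p ∣ c_n.
RigidDivSeq : (ℕ → ℤ) → Set
RigidDivSeq c = ∀ (p : ℕ) → Prime p → ∀ (n m : ℕ) →
  let N = suc n ; M = suc m in
  (+ p ∣ c n) → SameVal p (c n) (c (Data.Nat._∸_ (Data.Nat._*_ M N) 1))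

InfinitelyManyValues : (ℕ → ℤ) → Set
InfinitelyManyValues c = ∀ (L : List ℤ) → ∃ λ n → ¬ (c n ∈ L)

{-# OPTIONS --safe #-}
module Submission where

-- Write A j = f^j(0), so that b_(j+1) = g(A j) divides A (j+1) = g(A j) h(A j).  Since
-- A n is a polynomial expression in A 0 = 0, replacing 0 by A (m N) ≡ 0 shows
-- A (n + m N) ≡ A n, hence b_(M N) ≡ b_N (mod A (m N)).  If p ∣ b_N then p ∣ A N, and any
-- power of p dividing b_N or b_(M N) divides A N or A (M N), hence by rigidity of A also
-- A (m N); the congruence then transfers it from one of b_N, b_(M N) to the other.

open import Defs
open import Data.Nat using (ℕ; zero; suc) renaming (_+_ to _+ℕ_; _*_ to _*ℕ_)
import Data.Nat.Divisibility as ℕ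
open import Data.Nat.Primality using (Prime)
open import Data.Integer using (ℤ; +_; _+_; _*_; _-_; _^_)
open import Data.Integer.Properties using (+-identityˡ; +-identityʳ; *-zeroʳ)
import Data.Integer.Divisibility as Unsigned
open import Data.Integer.Divisibility.Signed
  using (_∣_; ∣-refl; ∣-trans; ∣ᵤ⇒∣; ∣⇒∣ᵤ; ∣m∣n⇒∣m+n; ∣m∣n⇒∣m-n; ∣n⇒∣m*n; ∣m⇒∣m*n)
open import Data.Integer.Tactic.RingSolver using (solve-∀)
open import Data.List using ([]; _∷_; map)
open import Data.Product using (_,_)
open import Function.Base using (_∘_)
open import Function.Bundles using (mk⇔; Equivalence)
open import Relation.Binary.PropositionalEquality using (_≡_; refl; sym; trans; cong; subst)

eval-⊕ : ∀ p q x → eval (p ⊕ q) x ≡ eval p x + eval q x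
eval-⊕ []      q       x = sym (+-identityˡ _)
eval-⊕ (a ∷ p) []      x = sym (+-identityʳ _)
eval-⊕ (a ∷ p) (b ∷ q) x rewrite eval-⊕ p q x = ring a b x (eval p x) (eval q x)
  where
  ring : ∀ a b x u v → a + b + x * (u + v) ≡ a + x * u + (b + x * v)
  ring = solve-∀

eval-map-* : ∀ a q x → eval (map (a *_) q) x ≡ a * eval q x
eval-map-* a []      x = sym (*-zeroʳ a)
eval-map-* a (b ∷ q) x rewrite eval-map-* a q x = ring a b x (eval q x)
  where
  ring : ∀ a b x u → a * b + x * (a * u) ≡ a * (b + x * u)
  ring = solve-∀

eval-⊗ : ∀ p q x → eval (p ⊗ q) x ≡ eval p x * eval q x
eval-⊗ []      q x = refl
eval-⊗ (a ∷ p) q x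
  rewrite eval-⊕ (map (a *_) q) (+ 0 ∷ (p ⊗ q)) x | eval-map-* a q x | eval-⊗ p q x
  = ring a x (eval p x) (eval q x)
  where
  ring : ∀ a x u v → a * v + (+ 0 + x * (u * v)) ≡ (a + x * u) * v
  ring = solve-∀

eval-coeff-zero : ∀ q x → (∀ i → coeff q i ≡ + 0) → eval q x ≡ + 0
eval-coeff-zero []      x q≈0 = refl
eval-coeff-zero (a ∷ q) x q≈0
  rewrite q≈0 0 | eval-coeff-zero q x (q≈0 ∘ suc) = cong (_+_ (+ 0)) (*-zeroʳ x)

eval-≈ : ∀ p q x → p ≈ q → eval p x ≡ eval q x
eval-≈ []      q       x p≈q = sym (eval-coeff-zero q x (sym ∘ p≈q))
eval-≈ (a ∷ p) []      x p≈q = eval-coeff-zero (a ∷ p) x p≈q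
eval-≈ (a ∷ p) (b ∷ q) x p≈q rewrite p≈q 0 | eval-≈ p q x (p≈q ∘ suc) = refl

eval-∣ₚ : ∀ {g f} → g ∣ₚ f → ∀ x → eval g x ∣ eval f x
eval-∣ₚ {g} {f} (h , f≈gh) x =
  subst (eval g x ∣_) (sym (trans (eval-≈ f (g ⊗ h) x f≈gh) (eval-⊗ g h x)))
        (∣m⇒∣m*n (eval h x) ∣-refl)

eval-∣-diff : ∀ P {d} x y → d ∣ x - y → d ∣ eval P x - eval P y
eval-∣-diff []      x y d∣x-y = ∣ᵤ⇒∣ (ℕ._∣0 _)
eval-∣-diff (a ∷ P) x y d∣x-y =
  subst (_ ∣_) (sym (ring a x y (eval P x) (eval P y)))
    (∣m∣n⇒∣m+n (∣n⇒∣m*n x (eval-∣-diff P x y d∣x-y)) (∣m⇒∣m*n (eval P y) d∣x-y))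
  where
  ring : ∀ a x y u v → a + x * u - (a + y * v) ≡ x * (u - v) + (x - y) * v
  ring = solve-∀

iterF-∣-diff : ∀ n f {d} x y → d ∣ x - y → d ∣ iterF n f x - iterF n f y
iterF-∣-diff zero    f x y d∣x-y = d∣x-y
iterF-∣-diff (suc n) f x y d∣x-y =
  eval-∣-diff f (iterF n f x) (iterF n f y) (iterF-∣-diff n f x y d∣x-y)

iterF-+ : ∀ a b f x → iterF (a +ℕ b) f x ≡ iterF a f (iterF b f x)
iterF-+ zero    b f x = refl
iterF-+ (suc a) b f x = cong (eval f) (iterF-+ a b f x)

orbit : Poly → ℕ → ℤ
orbit f j = iterF j f (+ 0)

orbit-∣-shift : ∀ f n m → orbit f m ∣ orbit f (n +ℕ m) - orbit f n
orbit-∣-shift f n m =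
  subst (λ z → orbit f m ∣ z - orbit f n) (sym (iterF-+ n m f (+ 0)))
    (iterF-∣-diff n f (orbit f m) (+ 0) (subst (orbit f m ∣_) (sym (+-identityʳ _)) ∣-refl))

rigid-∣-multiple : ∀ (a : ℕ → ℤ) {p n} → a 0 ≡ + 0 → RigidDivSeq (a ∘ suc) → Prime p →
  + p Unsigned.∣ a (suc n) →
  ∀ m k → (+ p) ^ k Unsigned.∣ a (suc n) → (+ p) ^ k Unsigned.∣ a (m *ℕ suc n)
rigid-∣-multiple a a0≡0 rigid p-prime p∣aN zero    k pᵏ∣aN rewrite a0≡0 = ℕ._∣0 _
rigid-∣-multiple a {n = n} a0≡0 rigid p-prime p∣aN (suc m) k pᵏ∣aN =
  Equivalence.to (rigid _ p-prime n m p∣aN k) pᵏ∣aN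

sameVal-of-∣-diff : ∀ {p u v d} →
  (∀ k → (+ p) ^ k Unsigned.∣ u → (+ p) ^ k Unsigned.∣ d) →
  (∀ k → (+ p) ^ k Unsigned.∣ v → (+ p) ^ k Unsigned.∣ d) →
  d ∣ v - u → SameVal p u v
sameVal-of-∣-diff {p} {u} {v} {d} u⇒d v⇒d d∣v-u k = mk⇔
  (λ pᵏ∣u → ∣⇒∣ᵤ (subst (pᵏ ∣_) (ring v u)
    (∣m∣n⇒∣m+n (∣-trans (∣ᵤ⇒∣ {i = d} (u⇒d k pᵏ∣u)) d∣v-u) (∣ᵤ⇒∣ {i = u} pᵏ∣u))))
  (λ pᵏ∣v → ∣⇒∣ᵤ (subst (pᵏ ∣_) (ring′ v u)
    (∣m∣n⇒∣m-n (∣ᵤ⇒∣ {i = v} pᵏ∣v) (∣-trans (∣ᵤ⇒∣ {i = d} (v⇒d k pᵏ∣v)) d∣v-u))))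
  where
  pᵏ : ℤ
  pᵏ = (+ p) ^ k
  ring : ∀ v u → v - u + u ≡ v
  ring = solve-∀
  ring′ : ∀ v u → v - (v - u) ≡ u
  ring′ = solve-∀

-- Separability, the critical point and the infinitude of values are not needed:
-- rigidity of (f^n(0)) alone suffices.
proposition5p4 : (f g : Poly) →
    (∀ (n : ℕ) → Separable (iterP (suc n) f)) →
    CriticalAt0 f →
    RigidDivSeq (λ n → iterF (suc n) f (+ 0)) →
    InfinitelyManyValues (λ n → iterF (suc n) f (+ 0)) →
    g ∣ₚ f →
    RigidDivSeq (λ n → eval g (iterF n f (+ 0)))
proposition5p4 f g _ _ rigid _ g∣f p p-prime n m p∣bₙ =
  sameVal-of-∣-diff {u = b n} {v = b (n +ℕ m *ℕ suc n)}
    (λ k → divides-orbit-mN k ∘ through-orbit ((+ p) ^ k) n)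
    (λ k → divides-orbit-mN k ∘ Equivalence.from (rigid p p-prime n m p∣orbitN k)
                            ∘ through-orbit ((+ p) ^ k) (n +ℕ m *ℕ suc n))
    (eval-∣-diff g (orbit f (n +ℕ m *ℕ suc n)) (orbit f n) (orbit-∣-shift f n (m *ℕ suc n)))
  where
  b : ℕ → ℤ
  b j = eval g (orbit f j)
  through-orbit : ∀ q j → q Unsigned.∣ b j → q Unsigned.∣ orbit f (suc j)
  through-orbit q j q∣bⱼ = ℕ.∣-trans q∣bⱼ (∣⇒∣ᵤ (eval-∣ₚ {g} {f} g∣f (orbit f j)))
  p∣orbitN : + p Unsigned.∣ orbit f (suc n)
  p∣orbitN = through-orbit (+ p) n p∣bₙ
  divides-orbit-mN : ∀ k → (+ p) ^ k Unsigned.∣ orbit f (suc n) →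
                     (+ p) ^ k Unsigned.∣ orbit f (m *ℕ suc n)
  divides-orbit-mN = rigid-∣-multiple (orbit f) refl rigid p-prime p∣orbitN m
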